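{- Let $\mathbb{K}$ be a finite field of characteristic different from $2$ and let $(a,b)\in(\mathbb{K}^*)^2$ with $a\neq b$ and $a,b\notin\{1_{\mathbb{K}},-1_{\mathbb{K}}\}$. If neither $\Delta_1:=a^2+4_{\mathbb{K}}ab^{ -1}(ab^{ -1}-1_{\mathbb{K}})$ nor $\Delta_2:=b^2+4_{\mathbb{K}}a^{ -1}b(a^{ -1}b-1_{\mathbb{K}})$ is a square in $\mathbb{K}$, then the $(a,b)$-dynomial minimal solution of $(E_{\mathbb{K}})$ is irreducible.
   Context: Let $A$ be a commutative unital ring ($0_A\neq 1_A$); $k_A$ denotes $1_A+\cdots+1_A$ ($k$ terms). For $a_1,\ldots,a_n\in A$ set $M_n(a_1,\ldots,a_n)=\begin{pmatrix} a_n & -1_A\\ 1_A & 0_A\end{pmatrix}\cdots\begin{pmatrix} a_1 & -1_A\\ 1_A & 0_A\end{pmatrix}$. An $n$-tuple is a solution of $(E_A)$ if $M_n(a_1,\ldots,a_n)=\pm \mathrm{Id}$. For tuples, $(a_1,\ldots,a_n)\oplus(b_1,\ldots,b_m)=(a_1+b_m,a_2,\ldots,a_{n-1},a_n+b_1,b_2,\ldots,b_{m-1})$. Write $(a_1,\ldots,a_n)\sim(b_1,\ldots,b_n)$ if $(b_1,\ldots,b_n)$ is obtained from $(a_1,\ldots,a_n)$ or from $(a_n,\ldots,a_1)$ by a cyclic permutation. A solution $(c_1,\ldots,c_n)$ with $n\geq 3$ is reducible if there exist a solution $(b_1,\ldots,b_l)$ and a tuple $(a_1,\ldots,a_m)$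 of elements of $A$ with $l,m\geq 3$ and $(c_1,\ldots,c_n)\sim(a_1,\ldots,a_m)\oplus(b_1,\ldots,b_l)$; otherwise it is irreducible. For $A$ finite and $a,b\in A$ with $a\neq b$, the $(a,b)$-dynomial minimal solution of $(E_A)$ is the solution of the form $(a,b,a,b,\ldots,a,b)$ (the pair $(a,b)$ repeated $k\geq 1$ times) of minimal size; it exists. -}

module Defs where

open import Level using (Level; _⊔_)
open import Algebra.Bundles using (CommutativeRing)
open import Data.Nat as ℕ using (ℕ; zero; suc)
open import Data.Fin using (Fin)
open import Data.Product using (Σ; ∃; _×_; _,_)
open import Data.Sum using (_⊎_)
open import Data.List using (List; []; _∷_; _++_; length; reverse; drop; take; concat; replicate)
open import Data.List.Relation.Binary.Pointwise using (Pointwise)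
open import Function.Bundles using (Inverse)
open import Relation.Nullary using (¬_)
import Relation.Binary.PropositionalEquality as ≡

module DefsR {c ℓ : Level} (R : CommutativeRing c ℓ) where
  open CommutativeRing R

  nat : ℕ → Carrier
  nat zero    = 0#
  nat (suc k) = 1# + nat k

  IsField : Set (c ⊔ ℓ)
  IsField = (¬ (1# ≈ 0#)) × (∀ x → ¬ (x ≈ 0#) → ∃ λ y → x * y ≈ 1#)

  IsFinite : Set (c ⊔ ℓ)
  IsFinite = ∃ λ n → Inverse setoid (≡.setoid (Fin n))

  IsSquare : Carrier → Set (c ⊔ ℓ)
  IsSquare x = ∃ λ y → y * y ≈ x

  record Mat : Set c where
    constructor mat
    field
      m11 m12 m21 m22 : Carrier
  open Mat public

  _·_ : Mat → Mat → Mat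
  mat p q r s · mat p' q' r' s' =
    mat (p * p' + q * r') (p * q' + q * s') (r * p' + s * r') (r * q' + s * s')

  Id : Mat
  Id = mat 1# 0# 0# 1#

  MId : Mat
  MId = mat (- 1#) 0# 0# (- 1#)

  _≈M_ : Mat → Mat → Set ℓ
  mat p q r s ≈M mat p' q' r' s' = (p ≈ p') × (q ≈ q') × (r ≈ r') × (s ≈ s')

  Ma : Carrier → Mat
  Ma a = mat a (- 1#) 1# 0#

  Mn : List Carrier → Mat
  Mn []       = Id
  Mn (a ∷ as) = Mn as · Ma a

  Solution : List Carrier → Set ℓ
  Solution as = (Mn as ≈M Id) ⊎ (Mn as ≈M MId)

  initLast : Carrier → List Carrier → List Carrier × Carrier
  initLast x []       = [] , x
  initLast x (y ∷ ys) with initLast y ys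
  ... | i , l = x ∷ i , l

  -- (a_1..a_n) ⊕ (b_1..b_m) = (a_1+b_m, a_2..a_{n-1}, a_n+b_1, b_2..b_{m-1});
  -- only meaningful for n, m ≥ 2 (only used with n, m ≥ 3); other cases are junk.
  _⊕_ : List Carrier → List Carrier → List Carrier
  (a₁ ∷ a₂ ∷ as) ⊕ (b₁ ∷ b₂ ∷ bs) with initLast a₂ as | initLast b₂ bs
  ... | am , an | bm , bl = (a₁ + bl) ∷ am ++ ((an + b₁) ∷ bm)
  _ ⊕ _ = []

  _≋_ : List Carrier → List Carrier → Set (c ⊔ ℓ)
  _≋_ = Pointwise _≈_

  IsRotation : List Carrier → List Carrier → Set (c ⊔ ℓ)
  IsRotation xs ys = ∃ λ k → ys ≋ (drop k xs ++ take k xs)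

  _∼_ : List Carrier → List Carrier → Set (c ⊔ ℓ)
  xs ∼ ys = IsRotation xs ys ⊎ IsRotation (reverse xs) ys

  Reducible : List Carrier → Set (c ⊔ ℓ)
  Reducible cs = ∃ λ bs → ∃ λ as →
    Solution bs × 3 ℕ.≤ length bs × 3 ℕ.≤ length as × cs ∼ (as ⊕ bs)

  Irreducible : List Carrier → Set (c ⊔ ℓ)
  Irreducible cs = Solution cs × 3 ℕ.≤ length cs × ¬ Reducible cs

  dyn : Carrier → Carrier → ℕ → List Carrier
  dyn a b k = concat (replicate k (a ∷ b ∷ []))

  IsMinimalDynomial : Carrier → Carrier → ℕ → Set ℓ
  IsMinimalDynomial a b k =
    1 ℕ.≤ k × Solution (dyn a b k) × (∀ j → 1 ℕ.≤ j → j ℕ.< k → ¬ Solution (dyn a b j))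

{-# OPTIONS --safe #-}
-- If (c) ∼ (a) ⊕ (b) with (b₁, …, b_l) a solution, some rotation or reversal of (c) is
-- pre ++ xs with |pre| ≥ 3 and xs = (b₂, …, b_{l-1}) nonempty, and M(b) = ±Id forces
-- M(xs)₁₁ = ±1.  Rotations and reversals of (a, b, …, a, b) are (x, y, …, x, y) with
-- {x, y} = {a, b}, so xs is (x, y)^i or (y, (x, y)^i).  With t = xy − 2 and U the Chebyshev
-- sequence of t, M((x, y)^i) is linear in U (i+1) and U i, which satisfy
-- U (i+1)² + U i² − t U (i+1) U i = 1.  For xs = (x, y)^i this and M(xs)₁₁ = U (i+1) + U i = ±1
-- give xy U (i+1) U i = 0; but U j = 0 makes (x, y)^j a solution, and 1 ≤ i < i+1 < k contradicts
-- the minimality of k.  For xs = (y, (x, y)^i), M(xs)₁₁ = y U (i+1) = ±1 and the same identity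
-- makes Δ(y, x⁻¹) a square: this is Δ₂ for (x, y) = (a, b) and Δ₁ for (x, y) = (b, a).

module Submission where

open import Defs
open import Level using (Level)
open import Algebra.Bundles using (CommutativeRing)
open import Data.Nat using (ℕ)
open import Data.Product using (_×_)
open import Relation.Nullary using (¬_)

open import Data.Nat as ℕ using (zero; suc; _≤_; _<_; z≤n; s≤s; _<?_)
open import Data.Nat.Properties using (module ≤-Reasoning; +-suc; +-mono-≤; +-monoˡ-≤; ≮⇒≥; ≤⇒≯; ≰⇒>; <⇒≤)
open import Data.Integer as ℤ using (ℤ; +_; -[1+_]; _⊖_; ∣_∣; sign)
open import Data.Integer.Properties using ([1+m]⊖[1+n]≡m⊖n)
open import Data.Sign as Sign using (Sign)
open import Data.Maybe using (Maybe; just; nothing)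
open import Data.Product using (∃; ∃₂; _,_; proj₁; proj₂)
open import Data.Sum as Sum using (_⊎_; inj₁; inj₂)
open import Data.List using (List; []; _∷_; _++_; length; reverse; drop; take)
open import Data.List.Properties using (length-++; ++-assoc; ++-identityʳ; unfold-reverse; take-all; drop-all)
open import Data.List.Relation.Binary.Pointwise using (Pointwise; []; _∷_)
open import Data.List.Relation.Binary.Pointwise.Properties using (Pointwise-length)
open import Function using (_∘_)
open import Relation.Nullary using (yes; no; contradiction)
open import Relation.Binary.PropositionalEquality as ≡ using (_≡_; cong; cong₂; subst)

-- The ring solver for K with coefficients in ℤ.  The optimised multiplication _×′_ is used
-- because it makes ⟦ + 1 ⟧ℤ reduce to 1#, so that solver terms match goals containing 1#.
module IntegerCoefficients {c ℓ : Level} (K : CommutativeRing c ℓ) where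
  open CommutativeRing K
  open import Algebra.Properties.Ring ring using (-0#≈0#; -‿involutive; -‿+-comm; -1*x≈-x)
  open import Algebra.Properties.CommutativeSemigroup +-commutativeSemigroup using (interchange)
  open import Algebra.Properties.CommutativeSemigroup *-commutativeSemigroup
    using () renaming (interchange to *-interchange)
  open import Algebra.Properties.Semiring.Mult.TCOptimised semiring using (1+×; ×-homo-+; ×1-homo-*)
    renaming (_×_ to _×′_)
  open import Algebra.Solver.Ring.AlmostCommutativeRing
    using (fromCommutativeRing; _-Raw-AlmostCommutative⟶_)
  open import Relation.Binary.Reasoning.Setoid setoid

  ⟦_⟧ℤ : ℤ → Carrier
  ⟦ + n      ⟧ℤ = n ×′ 1#
  ⟦ -[1+ n ] ⟧ℤ = - (suc n ×′ 1#)

  private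
    1+a-[1+b]≈a-b : ∀ a b → (1# + a) - (1# + b) ≈ a - b
    1+a-[1+b]≈a-b a b = begin
      (1# + a) - (1# + b)     ≈⟨ +-congˡ (-‿+-comm 1# b) ⟨
      (1# + a) + (- 1# - b)   ≈⟨ interchange 1# a (- 1#) (- b) ⟩
      (1# - 1#) + (a - b)     ≈⟨ +-congʳ (-‿inverseʳ 1#) ⟩
      0# + (a - b)            ≈⟨ +-identityˡ (a - b) ⟩
      a - b                   ∎

    ⊖-homo : ∀ m n → ⟦ m ⊖ n ⟧ℤ ≈ m ×′ 1# - n ×′ 1#
    ⊖-homo zero    zero    = sym (-‿inverseʳ 0#)
    ⊖-homo zero    (suc n) = sym (+-identityˡ _)
    ⊖-homo (suc m) zero    = sym (trans (+-congˡ -0#≈0#) (+-identityʳ _))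
    ⊖-homo (suc m) (suc n) = begin
      ⟦ suc m ⊖ suc n ⟧ℤ              ≡⟨ ≡.cong ⟦_⟧ℤ ([1+m]⊖[1+n]≡m⊖n m n) ⟩
      ⟦ m ⊖ n ⟧ℤ                      ≈⟨ ⊖-homo m n ⟩
      m ×′ 1# - n ×′ 1#                 ≈⟨ 1+a-[1+b]≈a-b _ _ ⟨
      (1# + m ×′ 1#) - (1# + n ×′ 1#)   ≈⟨ +-cong (1+× m 1#) (-‿cong (1+× n 1#)) ⟨
      suc m ×′ 1# - suc n ×′ 1#         ∎

    +-homo : ∀ i j → ⟦ i ℤ.+ j ⟧ℤ ≈ ⟦ i ⟧ℤ + ⟦ j ⟧ℤ
    +-homo (+ m)      (+ n)      = ×-homo-+ 1# m n
    +-homo (+ m)      -[1+ n ]   = ⊖-homo m (suc n)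
    +-homo -[1+ m ]   (+ n)      = trans (⊖-homo n (suc m)) (+-comm _ _)
    +-homo -[1+ m ]   -[1+ n ]   = begin
      - (suc (suc (m ℕ.+ n)) ×′ 1#)      ≡⟨ ≡.cong (λ k → - (suc k ×′ 1#)) (+-suc m n) ⟨
      - ((suc m ℕ.+ suc n) ×′ 1#)        ≈⟨ -‿cong (×-homo-+ 1# (suc m) (suc n)) ⟩
      - (suc m ×′ 1# + suc n ×′ 1#)       ≈⟨ -‿+-comm _ _ ⟨
      - (suc m ×′ 1#) + - (suc n ×′ 1#)   ∎

    σ : Sign → Carrier
    σ Sign.+ = 1#
    σ Sign.- = - 1#

    σ-homo : ∀ s t → σ (s Sign.* t) ≈ σ s * σ t
    σ-homo Sign.+ t      = sym (*-identityˡ _)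
    σ-homo Sign.- Sign.+ = sym (*-identityʳ _)
    σ-homo Sign.- Sign.- = sym (trans (-1*x≈-x _) (-‿involutive _))

    ◃-homo : ∀ s n → ⟦ s ℤ.◃ n ⟧ℤ ≈ σ s * (n ×′ 1#)
    ◃-homo s      zero    = sym (zeroʳ _)
    ◃-homo Sign.+ (suc n) = sym (*-identityˡ _)
    ◃-homo Sign.- (suc n) = sym (-1*x≈-x _)

    sign*abs : ∀ i → ⟦ i ⟧ℤ ≈ σ (sign i) * (∣ i ∣ ×′ 1#)
    sign*abs (+ n)    = sym (*-identityˡ _)
    sign*abs -[1+ n ] = sym (-1*x≈-x _)

    *-homo : ∀ i j → ⟦ i ℤ.* j ⟧ℤ ≈ ⟦ i ⟧ℤ * ⟦ j ⟧ℤ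
    *-homo i j = begin
      ⟦ sign i Sign.* sign j ℤ.◃ ∣ i ∣ ℕ.* ∣ j ∣ ⟧ℤ          ≈⟨ ◃-homo (sign i Sign.* sign j) (∣ i ∣ ℕ.* ∣ j ∣) ⟩
      σ (sign i Sign.* sign j) * ((∣ i ∣ ℕ.* ∣ j ∣) ×′ 1#)   ≈⟨ *-cong (σ-homo (sign i) (sign j)) (×1-homo-* ∣ i ∣ ∣ j ∣) ⟩
      (σ (sign i) * σ (sign j)) * (∣ i ∣ ×′ 1# * ∣ j ∣ ×′ 1#) ≈⟨ *-interchange _ _ _ _ ⟩
      (σ (sign i) * ∣ i ∣ ×′ 1#) * (σ (sign j) * ∣ j ∣ ×′ 1#) ≈⟨ *-cong (sign*abs i) (sign*abs j) ⟨
      ⟦ i ⟧ℤ * ⟦ j ⟧ℤ                                        ∎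

    -‿homo : ∀ i → ⟦ ℤ.- i ⟧ℤ ≈ - ⟦ i ⟧ℤ
    -‿homo (+ zero)  = sym -0#≈0#
    -‿homo (+ suc n) = refl
    -‿homo -[1+ n ]  = sym (-‿involutive _)

    homomorphism : ℤ.+-*-rawRing -Raw-AlmostCommutative⟶ fromCommutativeRing K
    homomorphism = record
      { ⟦_⟧ = ⟦_⟧ℤ ; +-homo = +-homo ; *-homo = *-homo ; -‿homo = -‿homo
      ; 0-homo = refl ; 1-homo = refl }

    ⟦⟧ℤ-≟ : ∀ i j → Maybe (⟦ i ⟧ℤ ≈ ⟦ j ⟧ℤ)
    ⟦⟧ℤ-≟ i j with i ℤ.≟ j
    ... | yes i≡j = just (reflexive (≡.cong ⟦_⟧ℤ i≡j))
    ... | no  _   = nothing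

  open import Algebra.Solver.Ring ℤ.+-*-rawRing (fromCommutativeRing K) homomorphism ⟦⟧ℤ-≟ public

module _ {a} {A : Set a} where

  rotate : ℕ → List A → List A
  rotate r xs = drop r xs ++ take r xs

  rotate-all : ∀ r xs → length xs ≤ r → rotate r xs ≡ xs
  rotate-all r xs len≤r rewrite drop-all r xs len≤r | take-all r xs len≤r = ≡.refl

  drop-++ˡ : ∀ r (xs ys : List A) → r ≤ length xs → drop r (xs ++ ys) ≡ drop r xs ++ ys
  drop-++ˡ zero    xs       ys _         = ≡.refl
  drop-++ˡ (suc r) (x ∷ xs) ys (s≤s r≤) = drop-++ˡ r xs ys r≤

  take-++ˡ : ∀ r (xs ys : List A) → r ≤ length xs → take r (xs ++ ys) ≡ take r xs
  take-++ˡ zero    xs       ys _         = ≡.refl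
  take-++ˡ (suc r) (x ∷ xs) ys (s≤s r≤) = cong (x ∷_) (take-++ˡ r xs ys r≤)

  rotate-suc : ∀ r x xs → r ≤ length xs → rotate (suc r) (x ∷ xs) ≡ rotate r (xs ++ x ∷ [])
  rotate-suc r x xs r≤ = begin
    drop r xs ++ x ∷ take r xs                           ≡⟨ ++-assoc (drop r xs) (x ∷ []) (take r xs) ⟨
    (drop r xs ++ x ∷ []) ++ take r xs                   ≡⟨ cong₂ _++_ (drop-++ˡ r xs _ r≤) (take-++ˡ r xs _ r≤) ⟨
    drop r (xs ++ x ∷ []) ++ take r (xs ++ x ∷ [])       ∎
    where open ≡.≡-Reasoning

  Pointwise-drop-++ : ∀ {b r} {B : Set b} {R : A → B → Set r} pre {xs ys} →
                      Pointwise R (pre ++ xs) ys → Pointwise R xs (drop (length pre) ys)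
  Pointwise-drop-++ []        xs≈ys       = xs≈ys
  Pointwise-drop-++ (_ ∷ pre) (_ ∷ xs≈ys) = Pointwise-drop-++ pre xs≈ys

m+m<n+n⇒m<n : ∀ {m n} → m ℕ.+ m < n ℕ.+ n → m < n
m+m<n+n⇒m<n {m} {n} m+m<n+n with m <? n
... | yes m<n = m<n
... | no  m≮n = contradiction m+m<n+n (≤⇒≯ (+-mono-≤ (≮⇒≥ m≮n) (≮⇒≥ m≮n)))

1≤m+m⇒1≤m : ∀ {m} → 1 ≤ m ℕ.+ m → 1 ≤ m
1≤m+m⇒1≤m {suc m} _ = s≤s z≤n

3+2i≤2k⇒2+i≤k : ∀ {i k} → 3 ℕ.+ (i ℕ.+ i) ≤ k ℕ.+ k → suc i < k
3+2i≤2k⇒2+i≤k {i} {k} 3+2i≤2k = m+m<n+n⇒m<n (subst (_< k ℕ.+ k) (≡.sym (+-suc (suc i) i)) 3+2i≤2k)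

module RingLemmas {c ℓ : Level} (K : CommutativeRing c ℓ) where
  open CommutativeRing K
  open DefsR K
  open import Algebra.Properties.Ring ring
    using (-‿involutive; -1*x≈-x; x≈y⇒x∙y⁻¹≈ε; x∙y⁻¹≈ε⇒x≈y; +-inverseˡ-unique)
  open import Relation.Binary.Reasoning.Setoid setoid
  open IntegerCoefficients K using (con; _:+_; _:*_; _:-_; _:=_; solve)

  -- An identity under hypotheses pᵢ ≈ qᵢ is proved by letting the solver check
  -- l ≈ m + k₁ * (p₁ - q₁) + … + kₙ * (pₙ - qₙ) and peeling off the summands with vanish,
  -- the innermost call removing the last summand.
  vanish : ∀ {l m k p q} → p ≈ q → l ≈ m + k * (p - q) → l ≈ m
  vanish {l} {m} {k} {p} {q} p≈q l≈ = begin
    l                ≈⟨ l≈ ⟩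
    m + k * (p - q)  ≈⟨ +-congˡ (*-congˡ (x≈y⇒x∙y⁻¹≈ε p≈q)) ⟩
    m + k * 0#       ≈⟨ +-congˡ (zeroʳ k) ⟩
    m + 0#           ≈⟨ +-identityʳ m ⟩
    m                ∎

  IsSquare-resp : ∀ {x y} → x ≈ y → IsSquare x → IsSquare y
  IsSquare-resp x≈y (w , w²≈x) = w , trans w²≈x x≈y

  infix 4 _≈±1
  _≈±1 : Carrier → Set ℓ
  x ≈±1 = x ≈ 1# ⊎ x ≈ - 1#

  ≈±1-resp : ∀ {x y} → x ≈ y → x ≈±1 → y ≈±1
  ≈±1-resp x≈y = Sum.map (trans (sym x≈y)) (trans (sym x≈y))

  -x≈±1⇒x≈±1 : ∀ {x} → - x ≈±1 → x ≈±1
  -x≈±1⇒x≈±1 {x} (inj₁ e) = inj₂ (trans (sym (-‿involutive x)) (-‿cong e))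
  -x≈±1⇒x≈±1 {x} (inj₂ e) = inj₁ (trans (sym (-‿involutive x)) (trans (-‿cong e) (-‿involutive 1#)))

  ≈±1⇒x*x≈1 : ∀ {x} → x ≈±1 → x * x ≈ 1#
  ≈±1⇒x*x≈1 (inj₁ x≈1)  = trans (*-cong x≈1 x≈1) (*-identityˡ 1#)
  ≈±1⇒x*x≈1 (inj₂ x≈-1) = trans (*-cong x≈-1 x≈-1) (trans (-1*x≈-x (- 1#)) (-‿involutive 1#))

  module _ (isField : IsField) where

    x≉0∧y≉0⇒x*y≉0 : ∀ {x y} → ¬ x ≈ 0# → ¬ y ≈ 0# → ¬ x * y ≈ 0#
    x≉0∧y≉0⇒x*y≉0 {x} {y} x≉0 y≉0 xy≈0 with proj₂ isField x x≉0
    ... | x⁻¹ , xx⁻¹≈1 = y≉0 (begin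
      y                ≈⟨ *-identityˡ y ⟨
      1# * y           ≈⟨ *-congʳ (trans (*-comm x⁻¹ x) xx⁻¹≈1) ⟨
      (x⁻¹ * x) * y    ≈⟨ *-assoc x⁻¹ x y ⟩
      x⁻¹ * (x * y)    ≈⟨ *-congˡ xy≈0 ⟩
      x⁻¹ * 0#         ≈⟨ zeroʳ x⁻¹ ⟩
      0#               ∎)

    -- Equality in K is not decidable, so only the double negation is available.
    x*x≈1⇒¬¬x≈±1 : ∀ {x} → x * x ≈ 1# → ¬ ¬ (x ≈±1)
    x*x≈1⇒¬¬x≈±1 {x} x²≈1 ¬x≈±1 =
      x≉0∧y≉0⇒x*y≉0 (¬x≈±1 ∘ inj₁ ∘ x∙y⁻¹≈ε⇒x≈y x 1#) (¬x≈±1 ∘ inj₂ ∘ +-inverseˡ-unique x 1#)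
        (vanish x²≈1 (solve 1 (λ x → (x :- con (+ 1)) :* (x :+ con (+ 1))
                                     := con (+ 0) :+ con (+ 1) :* (x :* x :- con (+ 1))) refl x))

module Continuants {c ℓ : Level} (K : CommutativeRing c ℓ) where
  open CommutativeRing K
  open DefsR K
  open RingLemmas K
  open IntegerCoefficients K using (Polynomial; con; _:+_; _:*_; :-_; _:-_; _:=_; solve)

  ≈M-refl : ∀ {A} → A ≈M A
  ≈M-refl = refl , refl , refl , refl

  ≈M-sym : ∀ {A B} → A ≈M B → B ≈M A
  ≈M-sym (e₁ , e₂ , e₃ , e₄) = sym e₁ , sym e₂ , sym e₃ , sym e₄

  ≈M-trans : ∀ {A B C} → A ≈M B → B ≈M C → A ≈M C
  ≈M-trans (e₁ , e₂ , e₃ , e₄) (f₁ , f₂ , f₃ , f₄) = trans e₁ f₁ , trans e₂ f₂ , trans e₃ f₃ , trans e₄ f₄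

  ·-cong : ∀ {A A′ B B′} → A ≈M A′ → B ≈M B′ → (A · B) ≈M (A′ · B′)
  ·-cong (e₁ , e₂ , e₃ , e₄) (f₁ , f₂ , f₃ , f₄) =
    +-cong (*-cong e₁ f₁) (*-cong e₂ f₃) , +-cong (*-cong e₁ f₂) (*-cong e₂ f₄) ,
    +-cong (*-cong e₃ f₁) (*-cong e₄ f₃) , +-cong (*-cong e₃ f₂) (*-cong e₄ f₄)

  ·-assoc : ∀ A B C → ((A · B) · C) ≈M (A · (B · C))
  ·-assoc (mat a₁ a₂ a₃ a₄) (mat b₁ b₂ b₃ b₄) (mat c₁ c₂ c₃ c₄) =
    entry a₁ a₂ c₁ c₃ , entry a₁ a₂ c₂ c₄ , entry a₃ a₄ c₁ c₃ , entry a₃ a₄ c₂ c₄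
    where
    entry : ∀ p q v w → (p * b₁ + q * b₃) * v + (p * b₂ + q * b₄) * w ≈ p * (b₁ * v + b₂ * w) + q * (b₃ * v + b₄ * w)
    entry p q v w = solve 8 (λ p q r s t u v w →
      (p :* r :+ q :* t) :* v :+ (p :* s :+ q :* u) :* w := p :* (r :* v :+ s :* w) :+ q :* (t :* v :+ u :* w))
      refl p q b₁ b₂ b₃ b₄ v w

  ·-identityˡ : ∀ A → (Id · A) ≈M A
  ·-identityˡ (mat p q r s) = entry p r , entry q s , entry′ p r , entry′ q s
    where
    entry : ∀ u v → 1# * u + 0# * v ≈ u
    entry = solve 2 (λ u v → con (+ 1) :* u :+ con (+ 0) :* v := u) refl
    entry′ : ∀ u v → 0# * u + 1# * v ≈ v
    entry′ = solve 2 (λ u v → con (+ 0) :* u :+ con (+ 1) :* v := v) refl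

  ·-identityʳ : ∀ A → (A · Id) ≈M A
  ·-identityʳ (mat p q r s) = entry p q , entry′ p q , entry r s , entry′ r s
    where
    entry : ∀ u v → u * 1# + v * 0# ≈ u
    entry = solve 2 (λ u v → u :* con (+ 1) :+ v :* con (+ 0) := u) refl
    entry′ : ∀ u v → u * 0# + v * 1# ≈ v
    entry′ = solve 2 (λ u v → u :* con (+ 0) :+ v :* con (+ 1) := v) refl

  Mn-cong : ∀ {xs ys} → xs ≋ ys → Mn xs ≈M Mn ys
  Mn-cong []            = ≈M-refl
  Mn-cong (x≈y ∷ xs≋ys) = ·-cong (Mn-cong xs≋ys) (x≈y , refl , refl , refl)

  Mn-∷ʳ : ∀ xs z → Mn (xs ++ z ∷ []) ≈M (Ma z · Mn xs)
  Mn-∷ʳ []       z = ≈M-trans (·-identityˡ (Ma z)) (≈M-sym (·-identityʳ (Ma z)))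
  Mn-∷ʳ (w ∷ xs) z = ≈M-trans (·-cong (Mn-∷ʳ xs z) ≈M-refl) (·-assoc (Ma z) (Mn xs) (Ma w))

  record PolyMat (n : ℕ) : Set where
    constructor pmat
    field p₁₁ p₁₂ p₂₁ p₂₂ : Polynomial n
  open PolyMat public

  infixl 7 _⊗_
  _⊗_ : ∀ {n} → PolyMat n → PolyMat n → PolyMat n
  pmat p q r s ⊗ pmat p′ q′ r′ s′ =
    pmat (p :* p′ :+ q :* r′) (p :* q′ :+ q :* s′) (r :* p′ :+ s :* r′) (r :* q′ :+ s :* s′)

  Maₚ : ∀ {n} → Polynomial n → PolyMat n
  Maₚ z = pmat z (:- con (+ 1)) (con (+ 1)) (con (+ 0))

  m22-border : ∀ b xs c → m22 (Mn (b ∷ xs ++ c ∷ [])) ≈ - m11 (Mn xs)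
  m22-border b xs c = trans (proj₂ (proj₂ (proj₂ (·-cong (Mn-∷ʳ xs c) (≈M-refl {Ma b})))))
    (solve 6 (λ b c p q r s → p₂₂ ((Maₚ c ⊗ pmat p q r s) ⊗ Maₚ b) := :- p) refl
      b c (m11 (Mn xs)) (m12 (Mn xs)) (m21 (Mn xs)) (m22 (Mn xs)))

  solution⇒inner≈±1 : ∀ b xs c → Solution (b ∷ xs ++ c ∷ []) → m11 (Mn xs) ≈±1
  solution⇒inner≈±1 b xs c sol = -x≈±1⇒x≈±1 (≈±1-resp (m22-border b xs c)
    (Sum.map (proj₂ ∘ proj₂ ∘ proj₂) (proj₂ ∘ proj₂ ∘ proj₂) sol))

  initLast-++ : ∀ x xs → x ∷ xs ≡ proj₁ (initLast x xs) ++ proj₂ (initLast x xs) ∷ []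
  initLast-++ x []       = ≡.refl
  initLast-++ x (y ∷ ys) = cong (x ∷_) (initLast-++ y ys)

  length-initLast : ∀ x xs → length (proj₁ (initLast x xs)) ≡ length xs
  length-initLast x []       = ≡.refl
  length-initLast x (y ∷ ys) = cong suc (length-initLast y ys)

  length-initLast-∷ʳ : ∀ x xs z → length (proj₁ (initLast x xs) ++ z ∷ []) ≡ length (x ∷ xs)
  length-initLast-∷ʳ x []       z = ≡.refl
  length-initLast-∷ʳ x (y ∷ ys) z = cong suc (length-initLast-∷ʳ y ys z)

  ⊕-split : ∀ as bs → 3 ≤ length as → 3 ≤ length bs →
    ∃₂ λ pre xs → ∃₂ λ b₁ bₗ →
      as ⊕ bs ≡ pre ++ xs × bs ≡ b₁ ∷ xs ++ bₗ ∷ [] × 3 ≤ length pre × 1 ≤ length xs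
  ⊕-split []              _               ()        _
  ⊕-split (_ ∷ [])        _               (s≤s ())  _
  ⊕-split (_ ∷ _ ∷ _)     []              _         ()
  ⊕-split (_ ∷ _ ∷ _)     (_ ∷ [])        _         (s≤s ())
  ⊕-split (a₁ ∷ a₂ ∷ as) (b₁ ∷ b₂ ∷ bs) 3≤as (s≤s (s≤s 1≤bs)) =
    a₁ + bₗ ∷ am ++ aₙ + b₁ ∷ [] , bm , b₁ , bₗ ,
    cong (a₁ + bₗ ∷_) (≡.sym (++-assoc am (aₙ + b₁ ∷ []) bm)) ,
    cong (b₁ ∷_) (initLast-++ b₂ bs) ,
    subst (3 ≤_) (cong suc (≡.sym (length-initLast-∷ʳ a₂ as (aₙ + b₁)))) 3≤as ,
    subst (1 ≤_) (≡.sym (length-initLast b₂ bs)) 1≤bs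
    where
    am = proj₁ (initLast a₂ as)
    aₙ = proj₂ (initLast a₂ as)
    bm = proj₁ (initLast b₂ bs)
    bₗ = proj₂ (initLast b₂ bs)

  reducible⇒inner-block : ∀ {cs} → Reducible cs →
    ∃₂ λ pre xs → cs ∼ (pre ++ xs) × 3 ≤ length pre × 1 ≤ length xs × m11 (Mn xs) ≈±1
  reducible⇒inner-block {cs} (bs , as , sol , 3≤bs , 3≤as , cs∼as⊕bs)
    with ⊕-split as bs 3≤as 3≤bs
  ... | pre , xs , b₁ , bₗ , as⊕bs≡ , bs≡ , 3≤pre , 1≤xs =
    pre , xs , subst (cs ∼_) as⊕bs≡ cs∼as⊕bs , 3≤pre , 1≤xs ,
    solution⇒inner≈±1 b₁ xs bₗ (subst Solution bs≡ sol)

module Dynomials {c ℓ : Level} (K : CommutativeRing c ℓ) where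
  open CommutativeRing K hiding (zero)
  open DefsR K
  open RingLemmas K
  open Continuants K
  open import Algebra.Properties.Ring ring using (-0#≈0#)
  open import Algebra.Properties.Monoid.Mult.TCOptimised +-monoid using (×ᵤ≈×) renaming (_×_ to _×′_)
  open IntegerCoefficients K using (Polynomial; con; _:+_; _:*_; :-_; _:-_; _:=_; solve)

  dyn-∷ʳ : ∀ x y k → dyn x y k ++ x ∷ [] ≡ x ∷ dyn y x k
  dyn-∷ʳ x y zero    = ≡.refl
  dyn-∷ʳ x y (suc k) = cong (λ zs → x ∷ y ∷ zs) (dyn-∷ʳ x y k)

  reverse-dyn : ∀ x y k → reverse (dyn x y k) ≡ dyn y x k
  reverse-dyn x y zero    = ≡.refl
  reverse-dyn x y (suc k) = begin
    reverse (x ∷ y ∷ dyn x y k)                 ≡⟨ unfold-reverse x (y ∷ dyn x y k) ⟩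
    reverse (y ∷ dyn x y k) ++ x ∷ []           ≡⟨ cong (_++ x ∷ []) (unfold-reverse y (dyn x y k)) ⟩
    (reverse (dyn x y k) ++ y ∷ []) ++ x ∷ []   ≡⟨ cong (λ zs → (zs ++ y ∷ []) ++ x ∷ []) (reverse-dyn x y k) ⟩
    (dyn y x k ++ y ∷ []) ++ x ∷ []             ≡⟨ cong (_++ x ∷ []) (dyn-∷ʳ y x k) ⟩
    y ∷ dyn x y k ++ x ∷ []                     ≡⟨ cong (y ∷_) (dyn-∷ʳ x y k) ⟩
    y ∷ x ∷ dyn y x k                           ∎
    where open ≡.≡-Reasoning

  length-dyn : ∀ x y k → length (dyn x y k) ≡ k ℕ.+ k
  length-dyn x y zero    = ≡.refl
  length-dyn x y (suc k) = cong suc (≡.trans (cong suc (length-dyn x y k)) (≡.sym (+-suc k k)))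

  rotate-dyn : ∀ r x y k → rotate r (dyn x y k) ≡ dyn x y k ⊎ rotate r (dyn x y k) ≡ dyn y x k
  rotate-dyn zero    x y k       = inj₁ (++-identityʳ (dyn x y k))
  rotate-dyn (suc r) x y zero    = inj₁ ≡.refl
  rotate-dyn (suc r) x y (suc k) with r ℕ.≤? length (y ∷ dyn x y k)
  ... | no  r≰ = inj₁ (rotate-all (suc r) (dyn x y (suc k)) (s≤s (<⇒≤ (≰⇒> r≰))))
  ... | yes r≤ = Sum.swap (subst (λ zs → zs ≡ dyn y x (suc k) ⊎ zs ≡ dyn x y (suc k))
                                  (≡.sym rotate≡) (rotate-dyn r y x (suc k)))
    where
    rotate≡ : rotate (suc r) (dyn x y (suc k)) ≡ rotate r (dyn y x (suc k))
    rotate≡ = ≡.trans (rotate-suc r x (y ∷ dyn x y k) r≤) (cong (rotate r ∘ (y ∷_)) (dyn-∷ʳ x y k))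

  ≋-rotate-dyn : ∀ {zs} r x y k → zs ≋ rotate r (dyn x y k) → zs ≋ dyn x y k ⊎ zs ≋ dyn y x k
  ≋-rotate-dyn {zs} r x y k zs≋ =
    Sum.map (λ e → subst (zs ≋_) e zs≋) (λ e → subst (zs ≋_) e zs≋) (rotate-dyn r x y k)

  ∼-dyn : ∀ x y k {zs} → dyn x y k ∼ zs → zs ≋ dyn x y k ⊎ zs ≋ dyn y x k
  ∼-dyn x y k (inj₁ (r , zs≋)) = ≋-rotate-dyn r x y k zs≋
  ∼-dyn x y k {zs} (inj₂ (r , zs≋)) =
    Sum.swap (≋-rotate-dyn r y x k (subst (λ ws → zs ≋ rotate r ws) (reverse-dyn x y k) zs≋))

  data DynSuffix (x y : Carrier) : List Carrier → Set c where
    even : ∀ i → DynSuffix x y (dyn x y i)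
    odd  : ∀ i → DynSuffix x y (y ∷ dyn x y i)

  drop-DynSuffix : ∀ {x y zs} n → DynSuffix x y zs → DynSuffix x y (drop n zs)
  drop-DynSuffix zero    s              = s
  drop-DynSuffix (suc n) (even zero)    = even zero
  drop-DynSuffix (suc n) (even (suc i)) = drop-DynSuffix n (odd i)
  drop-DynSuffix (suc n) (odd i)        = drop-DynSuffix n (even i)

  dyn-suffix : ∀ {x y k} pre {xs} → (pre ++ xs) ≋ dyn x y k →
               ∃ λ i → xs ≋ dyn x y i ⊎ xs ≋ (y ∷ dyn x y i)
  dyn-suffix {k = k} pre pre++xs≋ =
    classify (Pointwise-drop-++ pre pre++xs≋) (drop-DynSuffix (length pre) (even k))
    where
    classify : ∀ {x y xs zs} → xs ≋ zs → DynSuffix x y zs → ∃ λ i → xs ≋ dyn x y i ⊎ xs ≋ (y ∷ dyn x y i)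
    classify xs≋ (even i) = i , inj₁ xs≋
    classify xs≋ (odd i)  = i , inj₂ xs≋

  -- U t n = Uₙ₋₁(t/2) for the Chebyshev polynomials Uₙ of the second kind.
  U : Carrier → ℕ → Carrier
  U t zero          = 0#
  U t (suc zero)    = 1#
  U t (suc (suc n)) = t * U t (suc n) - U t n

  Q : Carrier → Carrier → Carrier → Carrier
  Q t u v = u * u + v * v - t * u * v

  Qₚ : ∀ {n} → Polynomial n → Polynomial n → Polynomial n → Polynomial n
  Qₚ t u v = u :* u :+ v :* v :- t :* u :* v

  U-invariant : ∀ t n → Q t (U t (suc n)) (U t n) ≈ 1#
  U-invariant t zero    = solve 1 (λ t → Qₚ t (con (+ 1)) (con (+ 0)) := con (+ 1)) refl t
  U-invariant t (suc n) = trans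
    (solve 3 (λ t u v → Qₚ t (t :* u :- v) u := Qₚ t u v) refl t (U t (suc n)) (U t n))
    (U-invariant t n)

  U-cong : ∀ {t t′} → t ≈ t′ → ∀ n → U t n ≈ U t′ n
  U-cong t≈t′ zero          = refl
  U-cong t≈t′ (suc zero)    = refl
  U-cong t≈t′ (suc (suc n)) = +-cong (*-cong t≈t′ (U-cong t≈t′ (suc n))) (-‿cong (U-cong t≈t′ n))

  trace₂ : Carrier → Carrier → Carrier
  trace₂ x y = x * y - (1# + 1#)

  trace₂-comm : ∀ x y → trace₂ x y ≈ trace₂ y x
  trace₂-comm x y = +-congʳ (*-comm x y)

  -- For M = Mn (x ∷ y ∷ []), with trace t = trace₂ x y and determinant 1, Cayley–Hamilton gives
  -- Mⁿ = U t (n+1) · Id + U t n · (M − t · Id); dynMat x y u v is u · Id + v · (M − t · Id).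
  dynMat : Carrier → Carrier → Carrier → Carrier → Mat
  dynMat x y u v = mat (u + v) (- (y * v)) (x * v) (u - (x * y - 1#) * v)

  dynMatₚ : ∀ {n} → Polynomial n → Polynomial n → Polynomial n → Polynomial n → PolyMat n
  dynMatₚ x y u v = pmat (u :+ v) (:- (y :* v)) (x :* v) (u :- (x :* y :- con (+ 1)) :* v)

  dynMat-base : ∀ x y → Id ≈M dynMat x y 1# 0#
  dynMat-base x y =
    solve 2 (λ x y → con (+ 1) := p₁₁ (dynMatₚ x y (con (+ 1)) (con (+ 0)))) refl x y ,
    solve 2 (λ x y → con (+ 0) := p₁₂ (dynMatₚ x y (con (+ 1)) (con (+ 0)))) refl x y ,
    solve 2 (λ x y → con (+ 0) := p₂₁ (dynMatₚ x y (con (+ 1)) (con (+ 0)))) refl x y ,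
    solve 2 (λ x y → con (+ 1) := p₂₂ (dynMatₚ x y (con (+ 1)) (con (+ 0)))) refl x y

  dynMat-step : ∀ x y u v → ((dynMat x y u v · Ma y) · Ma x) ≈M dynMat x y (trace₂ x y * u - v) u
  dynMat-step x y u v =
    solve 4 (λ x y u v → p₁₁ (step x y u v) := p₁₁ (next x y u v)) refl x y u v ,
    solve 4 (λ x y u v → p₁₂ (step x y u v) := p₁₂ (next x y u v)) refl x y u v ,
    solve 4 (λ x y u v → p₂₁ (step x y u v) := p₂₁ (next x y u v)) refl x y u v ,
    solve 4 (λ x y u v → p₂₂ (step x y u v) := p₂₂ (next x y u v)) refl x y u v
    where
    step next : ∀ {n} → Polynomial n → Polynomial n → Polynomial n → Polynomial n → PolyMat n
    step x y u v = (dynMatₚ x y u v ⊗ Maₚ y) ⊗ Maₚ x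
    next x y u v = dynMatₚ x y ((x :* y :- con (+ 2)) :* u :- v) u

  Mn-dyn : ∀ x y n → Mn (dyn x y n) ≈M dynMat x y (U (trace₂ x y) (suc n)) (U (trace₂ x y) n)
  Mn-dyn x y zero    = dynMat-base x y
  Mn-dyn x y (suc n) = ≈M-trans (·-cong (·-cong (Mn-dyn x y n) (≈M-refl {Ma y})) (≈M-refl {Ma x}))
                                (dynMat-step x y _ _)

  solution-dyn⇒xU≈0 : ∀ x y n → Solution (dyn x y n) → x * U (trace₂ x y) n ≈ 0#
  solution-dyn⇒xU≈0 x y n sol = trans (sym (m21-resp (Mn-dyn x y n))) (Sum.[ m21-resp , m21-resp ] sol)
    where
    m21-resp : ∀ {A B} → A ≈M B → m21 A ≈ m21 B
    m21-resp = proj₁ ∘ proj₂ ∘ proj₂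

  dyn-solution-length : ∀ {x y} k → ¬ x ≈ 0# → 1 ≤ k → Solution (dyn x y k) → 3 ≤ length (dyn x y k)
  dyn-solution-length (suc zero)    x≉0 _ sol =
    contradiction (trans (sym (*-identityʳ _)) (solution-dyn⇒xU≈0 _ _ 1 sol)) x≉0
  dyn-solution-length (suc (suc k)) _   _ _   = s≤s (s≤s (s≤s z≤n))

  dynMat-scalar : ∀ {x y u v ε} → u ≈ ε → v ≈ 0# → dynMat x y u v ≈M mat ε 0# 0# ε
  dynMat-scalar {x} {y} {u} {v} {ε} u≈ε v≈0 =
    trans (+-cong u≈ε v≈0) (+-identityʳ ε) ,
    trans (-‿cong (k*v≈0 y)) -0#≈0# ,
    k*v≈0 x ,
    trans (+-cong u≈ε (-‿cong (k*v≈0 (x * y - 1#)))) (trans (+-congˡ -0#≈0#) (+-identityʳ ε))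
    where
    k*v≈0 : ∀ k → k * v ≈ 0#
    k*v≈0 k = trans (*-congˡ v≈0) (zeroʳ k)

  ¬solution⇒U≉0 : IsField → ∀ x y n → ¬ Solution (dyn x y n) → ¬ U (trace₂ x y) n ≈ 0#
  ¬solution⇒U≉0 isField x y n ¬sol v≈0 = x*x≈1⇒¬¬x≈±1 isField u²≈1 (¬sol ∘ solution)
    where
    t = trace₂ x y
    u = U t (suc n)
    v = U t n
    u²≈1 : u * u ≈ 1#
    u²≈1 = vanish (U-invariant t n) (vanish v≈0
      (solve 3 (λ t u v → u :* u := con (+ 1) :+ con (+ 1) :* (Qₚ t u v :- con (+ 1))
                                      :+ (t :* u :- v) :* (v :- con (+ 0))) refl t u v))
    solution : u ≈±1 → Solution (dyn x y n)
    solution = Sum.map (λ u≈1 → ≈M-trans (Mn-dyn x y n) (dynMat-scalar u≈1 v≈0))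
                       (λ u≈-1 → ≈M-trans (Mn-dyn x y n) (dynMat-scalar u≈-1 v≈0))

  -- (u + v)² − Q t u v = (t + 2) u v = x y u v.
  even-block-vanishes : ∀ x y n → m11 (Mn (dyn x y n)) ≈±1 →
                        x * y * (U (trace₂ x y) (suc n) * U (trace₂ x y) n) ≈ 0#
  even-block-vanishes x y n m11≈±1 = vanish [u+v]²≈1 (vanish (U-invariant t n)
    (solve 4 (λ x y u v → x :* y :* (u :* v)
               := con (+ 0) :+ con (+ 1) :* ((u :+ v) :* (u :+ v) :- con (+ 1))
                            :+ :- con (+ 1) :* (Qₚ (x :* y :- con (+ 2)) u v :- con (+ 1)))
           refl x y (U t (suc n)) (U t n)))
    where
    t = trace₂ x y
    [u+v]²≈1 : (U t (suc n) + U t n) * (U t (suc n) + U t n) ≈ 1#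
    [u+v]²≈1 = ≈±1⇒x*x≈1 (≈±1-resp (proj₁ (Mn-dyn x y n)) m11≈±1)

  Δ : Carrier → Carrier → Carrier
  Δ x z = x * x + nat 4 * (x * z) * (x * z - 1#)

  Δ-comm : ∀ x z → Δ x z ≈ x * x + nat 4 * (z * x) * (z * x - 1#)
  Δ-comm x z = +-congˡ (*-cong (*-congˡ (*-comm x z)) (+-congʳ (*-comm x z)))

  -- (2v − t u)² is the discriminant of Q t u v = 1 as a quadratic in v; given (y u)² = 1
  -- and x z = 1 it equals Δ y z / (y z)².
  odd-block-square : ∀ x y z n → x * z ≈ 1# → m11 (Mn (y ∷ dyn x y n)) ≈±1 → IsSquare (Δ y z)
  odd-block-square x y z n xz≈1 m11≈±1 = y * z * ((1# + 1#) * v - t * u) , (begin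
    (y * z * ((1# + 1#) * v - t * u)) * (y * z * ((1# + 1#) * v - t * u))
      ≈⟨ vanish (U-invariant t n) (vanish [yu]²≈1 (vanish xz≈1 (solve 5 (λ x y z u v →
           (y :* z :* (con (+ 2) :* v :- tₚ x y :* u)) :* (y :* z :* (con (+ 2) :* v :- tₚ x y :* u))
           := y :* y :+ con (+ 4) :* (y :* z) :* (y :* z :- con (+ 1))
              :+ con (+ 4) :* y :* y :* z :* z :* (Qₚ (tₚ x y) u v :- con (+ 1))
              :+ z :* z :* (tₚ x y :* tₚ x y :- con (+ 4)) :* (y :* u :* (y :* u) :- con (+ 1))
              :+ (y :* y :* (x :* z :+ con (+ 1)) :- con (+ 4) :* y :* z) :* (x :* z :- con (+ 1)))
         refl x y z u v))) ⟩
    y * y + 4 ×′ 1# * (y * z) * (y * z - 1#)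
      ≈⟨ +-congˡ (*-congʳ (*-congʳ (×ᵤ≈× 4 1#))) ⟨
    Δ y z ∎)
    where
    open import Relation.Binary.Reasoning.Setoid setoid
    tₚ : ∀ {n} → Polynomial n → Polynomial n → Polynomial n
    tₚ x y = x :* y :- con (+ 2)
    t = trace₂ x y
    u = U t (suc n)
    v = U t n
    [yu]²≈1 : y * u * (y * u) ≈ 1#
    [yu]²≈1 = ≈±1⇒x*x≈1 (≈±1-resp (trans (proj₁ (·-cong (Mn-dyn x y n) (≈M-refl {Ma y})))
      (solve 4 (λ x y u v → p₁₁ (dynMatₚ x y u v ⊗ Maₚ y) := y :* u) refl x y u v)) m11≈±1)

  module _ (isField : IsField) {x y x⁻¹ : Carrier}
           (x≉0 : ¬ x ≈ 0#) (y≉0 : ¬ y ≈ 0#) (xx⁻¹≈1 : x * x⁻¹ ≈ 1#) where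

    dyn-has-no-inner-block : ∀ {k} pre xs → ¬ IsSquare (Δ y x⁻¹) →
      (∀ j → 1 ≤ j → j < k → ¬ U (trace₂ x y) j ≈ 0#) →
      (pre ++ xs) ≋ dyn x y k → 3 ≤ length pre → 1 ≤ length xs → ¬ m11 (Mn xs) ≈±1
    dyn-has-no-inner-block {k} pre xs Δ∉□ U≉0 pre++xs≋ 3≤pre 1≤xs m11≈±1
      with dyn-suffix {k = k} pre pre++xs≋
    ... | i , inj₂ xs≋ = Δ∉□ (odd-block-square x y x⁻¹ i xx⁻¹≈1 (≈±1-resp (proj₁ (Mn-cong xs≋)) m11≈±1))
    ... | i , inj₁ xs≋ =
      x≉0∧y≉0⇒x*y≉0 isField (x≉0∧y≉0⇒x*y≉0 isField x≉0 y≉0)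
                             (x≉0∧y≉0⇒x*y≉0 isField (U≉0 (suc i) (s≤s z≤n) 1+i<k) (U≉0 i 1≤i (<⇒≤ 1+i<k)))
        (even-block-vanishes x y i (≈±1-resp (proj₁ (Mn-cong xs≋)) m11≈±1))
      where
      length-xs : length xs ≡ i ℕ.+ i
      length-xs = ≡.trans (Pointwise-length xs≋) (length-dyn x y i)
      1≤i : 1 ≤ i
      1≤i = 1≤m+m⇒1≤m (subst (1 ≤_) length-xs 1≤xs)
      1+i<k : suc i < k
      1+i<k = 3+2i≤2k⇒2+i≤k (begin
        3 ℕ.+ (i ℕ.+ i)             ≤⟨ +-monoˡ-≤ (i ℕ.+ i) 3≤pre ⟩
        length pre ℕ.+ (i ℕ.+ i)    ≡⟨ cong (length pre ℕ.+_) length-xs ⟨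
        length pre ℕ.+ length xs    ≡⟨ length-++ pre ⟨
        length (pre ++ xs)          ≡⟨ Pointwise-length pre++xs≋ ⟩
        length (dyn x y k)          ≡⟨ length-dyn x y k ⟩
        k ℕ.+ k                     ∎)
        where open ≤-Reasoning

theorem5p8 : {c ℓ : Level} (K : CommutativeRing c ℓ) →
    let open CommutativeRing K
        open DefsR K
    in IsField → IsFinite → ¬ (nat 2 ≈ 0#) →
       (a b a⁻¹ b⁻¹ : Carrier) →
       ¬ (a ≈ 0#) → ¬ (b ≈ 0#) → a * a⁻¹ ≈ 1# → b * b⁻¹ ≈ 1# →
       ¬ (a ≈ b) →
       ¬ (a ≈ 1#) → ¬ (a ≈ - 1#) → ¬ (b ≈ 1#) → ¬ (b ≈ - 1#) →
       ¬ IsSquare (a * a + nat 4 * (a * b⁻¹) * (a * b⁻¹ - 1#)) →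
       ¬ IsSquare (b * b + nat 4 * (a⁻¹ * b) * (a⁻¹ * b - 1#)) →
       (k : ℕ) → IsMinimalDynomial a b k → Irreducible (dyn a b k)
theorem5p8 K isField _ _ a b a⁻¹ b⁻¹ a≉0 b≉0 aa⁻¹≈1 bb⁻¹≈1 _ _ _ _ _ Δ₁∉□ Δ₂∉□ k (1≤k , sol , minimal) =
  sol , dyn-solution-length k a≉0 1≤k sol , ¬reducible
  where
  open CommutativeRing K hiding (zero)
  open DefsR K
  open RingLemmas K
  open Continuants K
  open Dynomials K

  Uab≉0 : ∀ j → 1 ≤ j → j < k → ¬ U (trace₂ a b) j ≈ 0#
  Uab≉0 j 1≤j j<k = ¬solution⇒U≉0 isField a b j (minimal j 1≤j j<k)

  Uba≉0 : ∀ j → 1 ≤ j → j < k → ¬ U (trace₂ b a) j ≈ 0#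
  Uba≉0 j 1≤j j<k = Uab≉0 j 1≤j j<k ∘ trans (U-cong (trace₂-comm a b) j)

  ¬reducible : ¬ Reducible (dyn a b k)
  ¬reducible red with reducible⇒inner-block red
  ... | pre , xs , dyn∼ , 3≤pre , 1≤xs , m11≈±1 with ∼-dyn a b k dyn∼
  ... | inj₁ ≋ab = dyn-has-no-inner-block isField a≉0 b≉0 aa⁻¹≈1 pre xs
                     (Δ₂∉□ ∘ IsSquare-resp (Δ-comm b a⁻¹)) Uab≉0 ≋ab 3≤pre 1≤xs m11≈±1
  ... | inj₂ ≋ba = dyn-has-no-inner-block isField b≉0 a≉0 bb⁻¹≈1 pre xs Δ₁∉□ Uba≉0 ≋ba 3≤pre 1≤xs m11≈±1
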